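{- Let $T:\subseteq \mathbf{X} \rightrightarrows \mathbf{Y}$ be a transparent multivalued function between represented spaces $\mathbf{X}=(X,\delta_{\mathbf{X}})$ and $\mathbf{Y}=(Y,\delta_{\mathbf{Y}})$, and let $\mathbf{Z}=(Z,\delta_{\mathbf{Z}})$ be a subspace of $\mathbf{Y}$. Then the multivalued function $S:\subseteq \mathbf{X}\rightrightarrows \mathbf{Z}$ given by $S = T|_{\{x\in\mathrm{dom}(T)\,:\,T(x)\subseteq Z\}}$ (i.e. $S(x)=T(x)$ for $x$ in this set) is also transparent.
   Context: A represented space is a pair $\mathbf{X}=(X,\delta_{\mathbf{X}})$ with $\delta_{\mathbf{X}}:\subseteq\mathbb{N}^\mathbb{N}\to X$ a partial surjection. A partial function $F:\subseteq\mathbb{N}^\mathbb{N}\to\mathbb{N}^\mathbb{N}$ realizes a multivalued $f:\subseteq\mathbf{X}\rightrightarrows\mathbf{Y}$ if $\delta_{\mathbf{Y}}(F(p))\in f(\delta_{\mathbf{X}}(p))$ for all $p\in\mathrm{dom}(f\delta_{\mathbf{X}})$; $f$ is computable (continuous) if it has a computable (continuous) realizer. Composition of multivalued functions: $\mathrm{dom}(g\circ f)=\{x\in\mathrm{dom}(f): f(x)\subseteq\mathrm{dom}(g)\}$ and $g\circ f(x)=\bigcup_{y\in f(x)}g(y)$. A multivalued $f$ tightens $g$, written $f\preceq g$, if $\mathrm{dom}(g)\subseteq\mathrm{dom}(f)$ and $f(x)\subseteq g(x)$ for all $x\in\mathrm{dom}(g)$. $T:\subseteq\mathbf{X}\rightrightarrows\mathbf{Y}$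 is transparent if for every computable $g:\subseteq\mathbf{Y}\rightrightarrows\mathbf{Y}$ there is a computable $f:\subseteq\mathbf{X}\rightrightarrows\mathbf{X}$ with $T\circ f\preceq g\circ T$ (with the analogous notion obtained by replacing "computable" by "continuous" throughout). $\mathbf{Z}=(Z,\delta_{\mathbf{Z}})$ is a subspace of $\mathbf{Y}$ if $Z\subseteq Y$ and $\delta_{\mathbf{Z}}$ is the restriction of $\delta_{\mathbf{Y}}$ to $\{p\in\mathrm{dom}(\delta_{\mathbf{Y}}):\delta_{\mathbf{Y}}(p)\in Z\}$. -}

module Defs where

open import Level using (0ℓ)
open import Data.Nat using (ℕ; zero; suc; _+_; _*_; _<_)
open import Data.Fin using (Fin)
open import Data.Vec using (Vec; []; _∷_; lookup)
open import Data.List using (List; []; _∷_)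
open import Data.Product using (Σ; ∃; _×_; _,_; proj₁; proj₂)
open import Relation.Binary.PropositionalEquality using (_≡_; refl; subst)

Baire : Set
Baire = ℕ → ℕ

_≈B_ : Baire → Baire → Set
p ≈B q = ∀ n → p n ≡ q n

record PartialBaire : Set₁ where
  field
    dom : Baire → Set
    app : (p : Baire) → dom p → Baire
open PartialBaire public

-- Represented spaces.  δ is a partial surjection ℕ^ℕ ⇀ X, encoded as a
-- functional, surjective relation (δ p x  means  δ(p) = x).  δ-ext records
-- that δ depends on p only as a function (extensionally).

record RepSpace : Set₁ where
  field
    Carrier : Set
    δ       : Baire → Carrier → Set
    δ-ext   : ∀ {p q x} → p ≈B q → δ p x → δ q x
    δ-func  : ∀ {p x y} → δ p x → δ p y → x ≡ y
    δ-surj  : ∀ x → ∃ λ p → δ p x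
open RepSpace public

-- Multivalued functions f :⊆ X ⇉ Y, as relations: f x y  means  y ∈ f(x);
-- dom(f) = { x | f(x) ≠ ∅ }.

MV : Set → Set → Set₁
MV A B = A → B → Set

Dom : {A B : Set} → MV A B → A → Set
Dom f x = ∃ λ y → f x y

_∘MV_ : {A B C : Set} → MV B C → MV A B → MV A C
(g ∘MV f) x z = (∀ y → f x y → Dom g y) × (∃ λ y → f x y × g y z)

_⪯_ : {A B : Set} → MV A B → MV A B → Set
f ⪯ g = (∀ x → Dom g x → Dom f x) × (∀ x y → Dom g x → f x y → g x y)

Realizes : (X Y : RepSpace) → PartialBaire → MV (Carrier X) (Carrier Y) → Set
Realizes X Y F f =
  ∀ p x → δ X p x → Dom f x →
    Σ (dom F p) λ d → ∃ λ y → δ Y (app F p d) y × f x y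

RealizedIn : (PartialBaire → Set) → (X Y : RepSpace) →
             MV (Carrier X) (Carrier Y) → Set₁
RealizedIn C X Y f = ∃ λ (F : PartialBaire) → C F × Realizes X Y F f

Transparent : (PartialBaire → Set) → (X Y : RepSpace) →
              MV (Carrier X) (Carrier Y) → Set₁
Transparent C X Y T =
  ∀ (g : MV (Carrier Y) (Carrier Y)) → RealizedIn C Y Y g →
    ∃ λ (f : MV (Carrier X) (Carrier X)) →
      RealizedIn C X X f × ((T ∘MV f) ⪯ (g ∘MV T))

Continuous : PartialBaire → Set
Continuous F =
  ∀ p (d : dom F p) (n : ℕ) → ∃ λ m →
    ∀ q (e : dom F q) → (∀ i → i < m → p i ≡ q i) → app F q e n ≡ app F p d n

data Code : ℕ → Set where
  czero : ∀ {k} → Code k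
  csucc : Code 1
  cproj : ∀ {k} → Fin k → Code k
  ccomp : ∀ {k m} → Code m → Vec (Code k) m → Code k
  cprec : ∀ {k} → Code k → Code (suc (suc k)) → Code (suc k)
  cmu   : ∀ {k} → Code (suc k) → Code k

mutual
  data Eval : ∀ {k} → Code k → Vec ℕ k → ℕ → Set where
    ev-zero : ∀ {k} {xs : Vec ℕ k} → Eval czero xs 0
    ev-succ : ∀ {x} → Eval csucc (x ∷ []) (suc x)
    ev-proj : ∀ {k} {i : Fin k} {xs} → Eval (cproj i) xs (lookup xs i)
    ev-comp : ∀ {k m} {f : Code m} {gs : Vec (Code k) m} {xs ys y} →
              EvalVec gs xs ys → Eval f ys y → Eval (ccomp f gs) xs y
    ev-prec0 : ∀ {k} {f : Code k} {g} {xs y} →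
               Eval f xs y → Eval (cprec f g) (0 ∷ xs) y
    ev-precS : ∀ {k} {f : Code k} {g} {n xs r y} →
               Eval (cprec f g) (n ∷ xs) r → Eval g (n ∷ r ∷ xs) y →
               Eval (cprec f g) (suc n ∷ xs) y
    ev-mu : ∀ {k} {f : Code (suc k)} {xs y} →
            Eval f (y ∷ xs) 0 →
            (∀ i → i < y → ∃ λ v → Eval f (i ∷ xs) (suc v)) →
            Eval (cmu f) xs y

  data EvalVec : ∀ {k m} → Vec (Code k) m → Vec ℕ k → Vec ℕ m → Set where
    evv-nil  : ∀ {k} {xs : Vec ℕ k} → EvalVec [] xs []
    evv-cons : ∀ {k m} {g : Code k} {gs : Vec (Code k) m} {xs y ys} →
               Eval g xs y → EvalVec gs xs ys → EvalVec (g ∷ gs) xs (y ∷ ys)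

tri : ℕ → ℕ
tri zero    = 0
tri (suc n) = tri n + suc n

pair : ℕ → ℕ → ℕ
pair a b = tri (a + b) + b

codeList : List ℕ → ℕ
codeList []       = 0
codeList (a ∷ w)  = suc (pair a (codeList w))

prefix : Baire → ℕ → List ℕ
prefix p zero    = []
prefix p (suc m) = p 0 ∷ prefix (λ i → p (suc i)) m

-- F is computable iff some partial recursive ψ(⟨w⟩, n) computes the n-th
-- output symbol from finite prefixes w of the input, consistently:
-- for p ∈ dom F, ψ(⟨p[m]⟩, n) is defined for some m, and whenever it is
-- defined its value is F(p)(n).
Computable : PartialBaire → Set
Computable F =
  ∃ λ (c : Code 2) → ∀ p (d : dom F p) (n : ℕ) →
    (∃ λ m → Eval c (codeList (prefix p m) ∷ n ∷ []) (app F p d n)) ×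
    (∀ m y → Eval c (codeList (prefix p m) ∷ n ∷ []) y → y ≡ app F p d n)

IsPropPred : {A : Set} → (A → Set) → Set
IsPropPred P = ∀ a (u v : P a) → u ≡ v

private
  Σ-≡ : {A : Set} {P : A → Set} → IsPropPred P →
        ∀ {a b} {u : P a} {v : P b} → a ≡ b → _≡_ {A = Σ A P} (a , u) (b , v)
  Σ-≡ {P = P} pr {a} {u = u} {v} refl with pr a u v
  ... | refl = refl

Subspace : (Y : RepSpace) (Z : Carrier Y → Set) → IsPropPred Z → RepSpace
Subspace Y Z pr = record
  { Carrier = Σ (Carrier Y) Z
  ; δ       = λ p z → δ Y p (proj₁ z)
  ; δ-ext   = λ e d → δ-ext Y e d
  ; δ-func  = λ d e → Σ-≡ pr (δ-func Y d e)
  ; δ-surj  = λ z → δ-surj Y (proj₁ z)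
  }

restrictTo : {A B : Set} (T : MV A B) (Z : B → Set) → MV A (Σ B Z)
restrictTo T Z x z = T x (proj₁ z) × (∀ y → T x y → Z y)

module Submission where

open import Defs
open import Data.Product using (Σ; _×_; _,_; proj₁; proj₂)
open import Relation.Binary.PropositionalEquality using (refl)

-- Proof idea: a realizer of g : Z ⇉ Z also realizes the extension ĝ : Y ⇉ Y of g
-- (defined only on Z, with values in Z), since δ_Z is a restriction of δ_Y.
-- Transparency of T yields f with T ∘ f ⪯ ĝ ∘ T.  On dom(g ∘ S) every f-image x'
-- then has T(x') ⊆ Z, because ĝ only outputs points of Z; so S ∘ f ⪯ g ∘ S with
-- the same f.

extend : {B : Set} (Z : B → Set) → MV (Σ B Z) (Σ B Z) → MV B B
extend Z g y y′ = Σ (Z y) λ z → Σ (Z y′) λ z′ → g (y , z) (y′ , z′)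

module _ (Y : RepSpace) (Z : Carrier Y → Set) (Zprop : IsPropPred Z) where

  realizes-extend : ∀ {F g} → Realizes (Subspace Y Z Zprop) (Subspace Y Z Zprop) F g →
                    Realizes Y Y F (extend Z g)
  realizes-extend realizer p y δp (y′ , z , z′ , gyy′) =
    let (d , w , δw , gw) = realizer p (y , z) δp ((y′ , z′) , gyy′)
    in d , proj₁ w , δw , z , proj₂ w , gw

  realizedIn-extend : ∀ {C g} → RealizedIn C (Subspace Y Z Zprop) (Subspace Y Z Zprop) g →
                      RealizedIn C Y Y (extend Z g)
  realizedIn-extend (F , cF , realizer) = F , cF , realizes-extend realizer

module _ {A B : Set} (T : MV A B) (Z : B → Set) (g : MV (Σ B Z) (Σ B Z)) where

  private
    S = restrictTo T Z

  dom-∘restrict⇒dom-extend∘ : ∀ {x} → Dom (g ∘MV S) x → Dom (extend Z g ∘MV T) x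
  dom-∘restrict⇒dom-extend∘ (z , g-total , y , (Txy , Tx⊆Z) , gyz) =
    proj₁ z , extend-total , proj₁ y , Txy , proj₂ y , proj₂ z , gyz
    where
    extend-total : ∀ y → T _ y → Dom (extend Z g) y
    extend-total y Txy with g-total (y , Tx⊆Z y Txy) (Txy , Tx⊆Z)
    ... | w , gyw = proj₁ w , Tx⊆Z y Txy , proj₂ w , gyw

  module _ (Zprop : IsPropPred Z) (f : MV A A)
           (T∘f⪯ĝ∘T : (T ∘MV f) ⪯ (extend Z g ∘MV T)) where

    image-⊆Z : ∀ {x} → Dom (extend Z g ∘MV T) x → ∀ x′ → f x x′ → ∀ y → T x′ y → Z y
    image-⊆Z {x} D x′ fxx′ y Tx′y =
      let (_ , T-total , _) = proj₁ T∘f⪯ĝ∘T x D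
          (_ , _ , _ , _ , Zy , _) = proj₂ T∘f⪯ĝ∘T x y D (T-total , x′ , fxx′ , Tx′y)
      in Zy

    restrict-∘⪯ : (S ∘MV f) ⪯ (g ∘MV S)
    restrict-∘⪯ = dom-⊆ , value-⊆
      where
      dom-⊆ : ∀ x → Dom (g ∘MV S) x → Dom (S ∘MV f) x
      dom-⊆ x D′ =
        let D = dom-∘restrict⇒dom-extend∘ D′
            (y , T-total , x′ , fxx′ , Tx′y) = proj₁ T∘f⪯ĝ∘T x D
            S-total : ∀ x″ → f x x″ → Dom S x″
            S-total x″ fxx″ =
              let (y″ , Tx″y″) = T-total x″ fxx″
              in (y″ , image-⊆Z D x″ fxx″ y″ Tx″y″) , Tx″y″ , image-⊆Z D x″ fxx″
        in (y , image-⊆Z D x′ fxx′ y Tx′y) , S-total , x′ , fxx′ , Tx′y , image-⊆Z D x′ fxx′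

      value-⊆ : ∀ x z → Dom (g ∘MV S) x → (S ∘MV f) x z → (g ∘MV S) x z
      value-⊆ x (y , Zy) D′@(_ , g-total , _ , (_ , Tx⊆Z) , _) (S-total , x′ , fxx′ , Tx′y , _)
        with proj₂ T∘f⪯ĝ∘T x y (dom-∘restrict⇒dom-extend∘ D′)
               ((λ x″ fxx″ → let ((y″ , _) , Tx″y″ , _) = S-total x″ fxx″ in y″ , Tx″y″)
               , x′ , fxx′ , Tx′y)
      ... | _ , y₀ , Txy₀ , Zy₀ , Zy′ , gy₀y with Zprop y Zy′ Zy
      ... | refl = g-total , (y₀ , Zy₀) , (Txy₀ , Tx⊆Z) , gy₀y

transparent-restrict : (C : PartialBaire → Set) (X Y : RepSpace) (T : MV (Carrier X) (Carrier Y))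
                       (Z : Carrier Y → Set) (Zprop : IsPropPred Z) →
                       Transparent C X Y T → Transparent C X (Subspace Y Z Zprop) (restrictTo T Z)
transparent-restrict C X Y T Z Zprop transparent g realized =
  let (f , f-realized , T∘f⪯ĝ∘T) = transparent (extend Z g) (realizedIn-extend Y Z Zprop realized)
  in f , f-realized , restrict-∘⪯ T Z g Zprop f T∘f⪯ĝ∘T

mainTheorem1 : (X Y : RepSpace) (T : MV (Carrier X) (Carrier Y))
    (Z : Carrier Y → Set) (Zprop : IsPropPred Z) →
    (Transparent Computable X Y T →
      Transparent Computable X (Subspace Y Z Zprop) (restrictTo T Z))
    × (Transparent Continuous X Y T →
      Transparent Continuous X (Subspace Y Z Zprop) (restrictTo T Z))
mainTheorem1 X Y T Z Zprop =
  transparent-restrict Computable X Y T Z Zprop , transparent-restrict Continuous X Y T Z Zprop
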